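{- Let $R$ be a simple graph on vertex set $V$ and $B$ its complement on $V$. Assume $V$ is partitioned into two disjoint sets $W$ and $Z$ such that no edge of $B$ joins a vertex of $W$ to a vertex of $Z$. Assume that $R[W]$ has a non-trivial good orientation and that one of the following holds: (i) $R[Z]$ has a non-trivial good orientation; (ii) $|Z|=3$ and the vertices of $Z$ are isolated in $B$; (iii) $|Z|=2$. Then $R$ has an orientation of diameter $2$.
   Context: $R[W]$ denotes an induced subgraph. An orientation $O_W$ of $R[W]$ is good if there is a partition of $W$ into two sets $U_1,V_1$ such that $d_{O_W}(x,y)\le 2$ (directed distance) whenever $x,y$ are both in $U_1$ or both in $V_1$; it is non-trivial good if moreover every vertex of $U_1$ has an in-neighbor and an out-neighbor in $V_1$ and every vertex of $V_1$ has an in-neighbor and an out-neighbor in $U_1$. The diameter of a digraph is the maximum directed distance over ordered pairs of vertices. -}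

module Defs where

open import Data.Nat using (ℕ)
open import Data.Bool using (Bool)
open import Data.Fin using (Fin)
open import Data.Fin.Subset using (Subset; _∈_; _∉_; ⊤; ∁; ∣_∣)
open import Data.Product using (Σ; ∃; ∃-syntax; _×_; _,_)
open import Data.Sum using (_⊎_)
open import Relation.Nullary using (¬_)
open import Relation.Binary.PropositionalEquality using (_≡_; _≢_)
open import Relation.Binary using (Decidable)

record SimpleGraph (n : ℕ) : Set₁ where
  field
    Adj    : Fin n → Fin n → Set
    sym    : ∀ {x y} → Adj x y → Adj y x
    irrefl : ∀ {x} → ¬ Adj x x
    dec    : Decidable Adj
open SimpleGraph public

CoAdj : ∀ {n} → SimpleGraph n → Fin n → Fin n → Set
CoAdj R x y = x ≢ y × ¬ Adj R x y

record IsOrientation {n} (R : SimpleGraph n) (S : Subset n)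
                     (O : Fin n → Fin n → Set) : Set where
  field
    arc-src  : ∀ {x y} → O x y → x ∈ S
    arc-tgt  : ∀ {x y} → O x y → y ∈ S
    arc-edge : ∀ {x y} → O x y → Adj R x y
    edge-arc : ∀ {x y} → x ∈ S → y ∈ S → Adj R x y → O x y ⊎ O y x
    antisym  : ∀ {x y} → O x y → ¬ O y x

Dist≤1 : ∀ {n} → (Fin n → Fin n → Set) → Fin n → Fin n → Set
Dist≤1 O x y = x ≡ y ⊎ O x y

Dist≤2 : ∀ {n} → (Fin n → Fin n → Set) → Fin n → Fin n → Set
Dist≤2 O x y = Dist≤1 O x y ⊎ ∃[ z ] (O x z × O z y)

-- Good orientation of R[S]: the partition of S into U₁, V₁ is encoded by a
-- colouring side : Fin n → Bool (U₁ = S ∩ side⁻¹ true, V₁ = S ∩ side⁻¹ false).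
IsGood : ∀ {n} → SimpleGraph n → Subset n → (Fin n → Fin n → Set)
       → (Fin n → Bool) → Set
IsGood R S O side =
  IsOrientation R S O ×
  (∀ x y → x ∈ S → y ∈ S → side x ≡ side y → Dist≤2 O x y)

IsNonTrivialGood : ∀ {n} → SimpleGraph n → Subset n → (Fin n → Fin n → Set)
                 → (Fin n → Bool) → Set
IsNonTrivialGood R S O side =
  IsGood R S O side ×
  (∀ x → x ∈ S → ∃[ y ] (y ∈ S × side y ≢ side x × O y x)) ×
  (∀ x → x ∈ S → ∃[ y ] (y ∈ S × side y ≢ side x × O x y))

HasNonTrivialGoodOrientation : ∀ {n} → SimpleGraph n → Subset n → Set₁
HasNonTrivialGoodOrientation {n} R S =
  Σ (Fin n → Fin n → Set) λ O → ∃[ side ] IsNonTrivialGood R S O side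

HasDiameter2 : ∀ {n} → (Fin n → Fin n → Set) → Set
HasDiameter2 O = (∀ x y → Dist≤2 O x y) × ∃[ x ] ∃[ y ] ¬ Dist≤1 O x y

HasOrientationOfDiameter2 : ∀ {n} → SimpleGraph n → Set₁
HasOrientationOfDiameter2 {n} R =
  Σ (Fin n → Fin n → Set) λ O → IsOrientation R ⊤ O × HasDiameter2 O

module Submission where

-- Orient R[W] and R[Z] by good orientations with sides sW and sZ, and every W–Z edge (all of them
-- are present, since B has no W–Z edges) from W to Z exactly when sW and sZ agree on its ends.
-- Same-side pairs inside W or Z are at distance ≤ 2 already; two vertices on different sides of W
-- are joined through a vertex of Z on the side of the first, and dually for Z; a cross pair whose
-- edge points the wrong way is repaired by the in- or out-neighbour on the other side that
-- non-triviality of W provides. So Z only needs a good orientation using both sides: in case (ii)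
-- the cyclic triangle a → b → c → a with sides {b}, {a, c}, in case (iii) any orientation with two
-- singleton sides. The diameter is not 1 because an arc of R[W] has no reverse arc.

open import Defs renaming (sym to Adj-sym)
open import Data.Nat using (ℕ; suc) renaming (_<_ to _<ℕ_)
open import Data.Nat.Properties using (suc-injective; n≮0)
open import Data.Bool using (Bool; true; false)
open import Data.Bool.Properties using (¬-not) renaming (_≟_ to _≟ᵇ_)
open import Data.Fin using (Fin; _<_; _≟_)
open import Data.Fin.Properties using (<-cmp; <-asym)
open import Data.Fin.Subset using (Subset; _∈_; _∉_; ∣_∣; ∁; ⊤; _-_; _─_; ⁅_⁆; inside; outside)
open import Data.Fin.Subset.Properties
  using (_∈?_; ∈⊤; x∈∁p⇒x∉p; x∉p⇒x∈∁p; p─⊥≡p; p─q⊆p; x∈p∧x≢y⇒x∈p-y; x∉⁅y⁆⇒x≢y; x∈p⇒∣p-x∣<∣p∣)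
open import Data.Vec.Base using (_∷_; here; there)
open import Data.Product using (Σ; ∃-syntax; _×_; _,_; proj₁; proj₂)
open import Data.Sum using (_⊎_; inj₁; inj₂)
open import Data.Empty using (⊥-elim)
open import Function using (_∘_)
open import Relation.Nullary using (¬_; yes; no; does)
open import Relation.Nullary.Decidable using (dec-true; dec-false)
open import Relation.Binary using (tri<; tri≈; tri>)
open import Relation.Binary.PropositionalEquality using (_≡_; _≢_; refl; sym; trans; cong; subst; ≢-sym)

private
  variable
    n k : ℕ
    p q : Subset n
    x y : Fin n

∣p∣≡0⇒x∉p : ∣ p ∣ ≡ 0 → x ∉ p
∣p∣≡0⇒x∉p {p = p} {x = x} ∣p∣≡0 x∈p = n≮0 (subst (∣ p - x ∣ <ℕ_) ∣p∣≡0 (x∈p⇒∣p-x∣<∣p∣ x∈p))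

∣p∣≡1+k⇒∣p-x∣≡k : (p : Subset n) → ∣ p ∣ ≡ suc k → ∃[ x ] (x ∈ p × ∣ p - x ∣ ≡ k)
∣p∣≡1+k⇒∣p-x∣≡k (inside ∷ p) ∣p∣≡1+k =
  _ , here , trans (cong ∣_∣ (p─⊥≡p p)) (suc-injective ∣p∣≡1+k)
∣p∣≡1+k⇒∣p-x∣≡k (outside ∷ p) ∣p∣≡1+k with ∣p∣≡1+k⇒∣p-x∣≡k p ∣p∣≡1+k
... | x , x∈p , ∣p-x∣≡k = _ , there x∈p , ∣p-x∣≡k

x∈p─q⇒x∉q : x ∈ p ─ q → x ∉ q
x∈p─q⇒x∉q {p = inside ∷ _} {q = outside ∷ _} here ()
x∈p─q⇒x∉q {p = _ ∷ _} {q = _ ∷ _} (there x∈p─q) (there x∈q) = x∈p─q⇒x∉q x∈p─q x∈q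

x∈p-y⇒x≢y : x ∈ p - y → x ≢ y
x∈p-y⇒x≢y = x∉⁅y⁆⇒x≢y ∘ x∈p─q⇒x∉q

x∈p-y⇒x∈p : x ∈ p - y → x ∈ p
x∈p-y⇒x∈p {p = p} {y = y} = p─q⊆p p ⁅ y ⁆

x∈p⇒x≡y⊎x∈p-y : x ∈ p → x ≡ y ⊎ x ∈ p - y
x∈p⇒x≡y⊎x∈p-y {x = x} {y = y} x∈p with x ≟ y
... | yes x≡y = inj₁ x≡y
... | no x≢y  = inj₂ (x∈p∧x≢y⇒x∈p-y x∈p x≢y)

∣p∣≡2⇒pair : (p : Subset n) → ∣ p ∣ ≡ 2 →
  ∃[ a ] ∃[ b ] (a ∈ p × b ∈ p × b ≢ a × (∀ {x} → x ∈ p → x ≡ a ⊎ x ≡ b))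
∣p∣≡2⇒pair p ∣p∣≡2 with ∣p∣≡1+k⇒∣p-x∣≡k p ∣p∣≡2
... | a , a∈p , ∣p-a∣≡1 with ∣p∣≡1+k⇒∣p-x∣≡k (p - a) ∣p-a∣≡1
...   | b , b∈p-a , ∣p-a-b∣≡0 = a , b , a∈p , x∈p-y⇒x∈p b∈p-a , x∈p-y⇒x≢y b∈p-a , cover
  where
  cover : x ∈ p → x ≡ a ⊎ x ≡ b
  cover x∈p with x∈p⇒x≡y⊎x∈p-y x∈p
  ... | inj₁ x≡a = inj₁ x≡a
  ... | inj₂ x∈p-a with x∈p⇒x≡y⊎x∈p-y x∈p-a
  ...   | inj₁ x≡b = inj₂ x≡b
  ...   | inj₂ x∈p-a-b = ⊥-elim (∣p∣≡0⇒x∉p ∣p-a-b∣≡0 x∈p-a-b)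

∣p∣≡3⇒triple : (p : Subset n) → ∣ p ∣ ≡ 3 →
  ∃[ a ] ∃[ b ] ∃[ c ] (a ∈ p × b ∈ p × c ∈ p × b ≢ a × c ≢ b × c ≢ a ×
                        (∀ {x} → x ∈ p → x ≡ a ⊎ x ≡ b ⊎ x ≡ c))
∣p∣≡3⇒triple p ∣p∣≡3 with ∣p∣≡1+k⇒∣p-x∣≡k p ∣p∣≡3
... | a , a∈p , ∣p-a∣≡2 with ∣p∣≡2⇒pair (p - a) ∣p-a∣≡2
...   | b , c , b∈p-a , c∈p-a , c≢b , cover-p-a =
  a , b , c , a∈p , x∈p-y⇒x∈p b∈p-a , x∈p-y⇒x∈p c∈p-a ,
  x∈p-y⇒x≢y b∈p-a , c≢b , x∈p-y⇒x≢y c∈p-a , cover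
  where
  cover : x ∈ p → x ≡ a ⊎ x ≡ b ⊎ x ≡ c
  cover x∈p with x∈p⇒x≡y⊎x∈p-y x∈p
  ... | inj₁ x≡a = inj₁ x≡a
  ... | inj₂ x∈p-a = inj₂ (cover-p-a x∈p-a)

¬CoAdj⇒Adj : (R : SimpleGraph n) → x ≢ y → ¬ CoAdj R x y → Adj R x y
¬CoAdj⇒Adj {x = x} {y = y} R x≢y ¬co with dec R x y
... | yes xy = xy
... | no ¬xy = ⊥-elim (¬co (x≢y , ¬xy))

Dist≤2-map : {O O′ : Fin n → Fin n → Set} → (∀ {u v} → O u v → O′ u v) →
             Dist≤2 O x y → Dist≤2 O′ x y
Dist≤2-map f (inj₁ (inj₁ x≡y))       = inj₁ (inj₁ x≡y)
Dist≤2-map f (inj₁ (inj₂ xy))        = inj₁ (inj₂ (f xy))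
Dist≤2-map f (inj₂ (z , xz , zy))    = inj₂ (z , f xz , f zy)

both≢⇒≡ : {a b c : Bool} → b ≢ a → c ≢ a → b ≡ c
both≢⇒≡ b≢a c≢a = trans (¬-not b≢a) (sym (¬-not c≢a))

BothSides : Subset n → (Fin n → Bool) → Set
BothSides S side = ∀ b → ∃[ x ] (x ∈ S × side x ≡ b)

HasTwoSidedGoodOrientation : SimpleGraph n → Subset n → Set₁
HasTwoSidedGoodOrientation {n} R S =
  Σ (Fin n → Fin n → Set) λ O → ∃[ side ] (IsGood R S O side × BothSides S side)

module _ {R : SimpleGraph n} {S : Subset n} {O : Fin n → Fin n → Set} {side : Fin n → Bool} where

  nonTrivialGood⇒bothSides : ∃[ x ] x ∈ S → IsNonTrivialGood R S O side → BothSides S side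
  nonTrivialGood⇒bothSides (x , x∈S) (_ , in-neighbour , _) b with side x ≟ᵇ b
  ... | yes sx≡b = x , x∈S , sx≡b
  ... | no sx≢b with in-neighbour x x∈S
  ...   | y , y∈S , sy≢sx , _ = y , y∈S , both≢⇒≡ sy≢sx (sx≢b ∘ sym)

  injectiveSide⇒isGood : IsOrientation R S O →
    (∀ {x y} → x ∈ S → y ∈ S → side x ≡ side y → x ≡ y) → IsGood R S O side
  injectiveSide⇒isGood isO injective =
    isO , λ _ _ x∈S y∈S sx≡sy → inj₁ (inj₁ (injective x∈S y∈S sx≡sy))

nonTrivialGood⇒twoSidedGood : {R : SimpleGraph n} {S : Subset n} → ∃[ x ] x ∈ S →
  HasNonTrivialGoodOrientation R S → HasTwoSidedGoodOrientation R S
nonTrivialGood⇒twoSidedGood S-nonempty (O , side , nt) =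
  O , side , proj₁ nt , nonTrivialGood⇒bothSides S-nonempty nt

OrderOrientation : SimpleGraph n → Subset n → Fin n → Fin n → Set
OrderOrientation R S x y = x ∈ S × y ∈ S × Adj R x y × x < y

orderOrientation-isOrientation : (R : SimpleGraph n) (S : Subset n) →
  IsOrientation R S (OrderOrientation R S)
orderOrientation-isOrientation R S = record
  { arc-src  = λ (x∈S , _) → x∈S
  ; arc-tgt  = λ (_ , y∈S , _) → y∈S
  ; arc-edge = λ (_ , _ , xy , _) → xy
  ; edge-arc = edge-arc
  ; antisym  = λ (_ , _ , _ , x<y) (_ , _ , _ , y<x) → <-asym x<y y<x
  }
  where
  edge-arc : x ∈ S → y ∈ S → Adj R x y → OrderOrientation R S x y ⊎ OrderOrientation R S y x
  edge-arc {x} {y} x∈S y∈S xy with <-cmp x y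
  ... | tri< x<y _ _ = inj₁ (x∈S , y∈S , xy , x<y)
  ... | tri≈ _ refl _ = ⊥-elim (irrefl R xy)
  ... | tri> _ _ y<x = inj₂ (y∈S , x∈S , Adj-sym R xy , y<x)

∣S∣≡2⇒twoSidedGood : (R : SimpleGraph n) (S : Subset n) → ∣ S ∣ ≡ 2 →
  HasTwoSidedGoodOrientation R S
∣S∣≡2⇒twoSidedGood {n} R S ∣S∣≡2 with ∣p∣≡2⇒pair S ∣S∣≡2
... | a , b , a∈S , b∈S , b≢a , cover =
  OrderOrientation R S , side ,
  injectiveSide⇒isGood (orderOrientation-isOrientation R S) injective , bothSides
  where
  side : Fin n → Bool
  side x = does (x ≟ a)

  side-a : side a ≡ true
  side-a = dec-true (a ≟ a) refl

  side-b : side b ≡ false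
  side-b = dec-false (b ≟ a) b≢a

  bothSides : BothSides S side
  bothSides true  = a , a∈S , side-a
  bothSides false = b , b∈S , side-b

  side-a≢side-b : side a ≢ side b
  side-a≢side-b e with trans (sym side-a) (trans e side-b)
  ... | ()

  injective : x ∈ S → y ∈ S → side x ≡ side y → x ≡ y
  injective x∈S y∈S sx≡sy with cover x∈S | cover y∈S
  ... | inj₁ refl | inj₁ refl = refl
  ... | inj₂ refl | inj₂ refl = refl
  ... | inj₁ refl | inj₂ refl = ⊥-elim (side-a≢side-b sx≡sy)
  ... | inj₂ refl | inj₁ refl = ⊥-elim (side-a≢side-b (sym sx≡sy))

module CyclicTriangle (R : SimpleGraph n) (S : Subset n) {a b c : Fin n}
  (a∈S : a ∈ S) (b∈S : b ∈ S) (c∈S : c ∈ S) (b≢a : b ≢ a) (c≢b : c ≢ b) (c≢a : c ≢ a)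
  (cover : ∀ {x} → x ∈ S → x ≡ a ⊎ x ≡ b ⊎ x ≡ c)
  (complete : ∀ {x y} → x ∈ S → y ∈ S → x ≢ y → Adj R x y)
  where

  data Arc (x y : Fin n) : Set where
    a→b : x ≡ a → y ≡ b → Arc x y
    b→c : x ≡ b → y ≡ c → Arc x y
    c→a : x ≡ c → y ≡ a → Arc x y

  arc-src : Arc x y → x ∈ S
  arc-src (a→b refl _) = a∈S
  arc-src (b→c refl _) = b∈S
  arc-src (c→a refl _) = c∈S

  arc-tgt : Arc x y → y ∈ S
  arc-tgt (a→b _ refl) = b∈S
  arc-tgt (b→c _ refl) = c∈S
  arc-tgt (c→a _ refl) = a∈S

  arc-≢ : Arc x y → x ≢ y
  arc-≢ (a→b refl refl) = ≢-sym b≢a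
  arc-≢ (b→c refl refl) = ≢-sym c≢b
  arc-≢ (c→a refl refl) = c≢a

  edge-arc : x ∈ S → y ∈ S → Adj R x y → Arc x y ⊎ Arc y x
  edge-arc x∈S y∈S xy with cover x∈S | cover y∈S
  ... | inj₁ refl        | inj₁ refl        = ⊥-elim (irrefl R xy)
  ... | inj₂ (inj₁ refl) | inj₂ (inj₁ refl) = ⊥-elim (irrefl R xy)
  ... | inj₂ (inj₂ refl) | inj₂ (inj₂ refl) = ⊥-elim (irrefl R xy)
  ... | inj₁ refl        | inj₂ (inj₁ refl) = inj₁ (a→b refl refl)
  ... | inj₂ (inj₁ refl) | inj₂ (inj₂ refl) = inj₁ (b→c refl refl)
  ... | inj₂ (inj₂ refl) | inj₁ refl        = inj₁ (c→a refl refl)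
  ... | inj₂ (inj₁ refl) | inj₁ refl        = inj₂ (a→b refl refl)
  ... | inj₂ (inj₂ refl) | inj₂ (inj₁ refl) = inj₂ (b→c refl refl)
  ... | inj₁ refl        | inj₂ (inj₂ refl) = inj₂ (c→a refl refl)

  antisym : Arc x y → ¬ Arc y x
  antisym (a→b refl refl) (a→b b≡a _) = b≢a b≡a
  antisym (a→b refl refl) (b→c _ a≡c) = c≢a (sym a≡c)
  antisym (a→b refl refl) (c→a b≡c _) = c≢b (sym b≡c)
  antisym (b→c refl refl) (a→b c≡a _) = c≢a c≡a
  antisym (b→c refl refl) (b→c c≡b _) = c≢b c≡b
  antisym (b→c refl refl) (c→a _ b≡a) = b≢a b≡a
  antisym (c→a refl refl) (a→b _ c≡b) = c≢b c≡b
  antisym (c→a refl refl) (b→c a≡b _) = b≢a (sym a≡b)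
  antisym (c→a refl refl) (c→a a≡c _) = c≢a (sym a≡c)

  isOrientation : IsOrientation R S Arc
  isOrientation = record
    { arc-src  = arc-src
    ; arc-tgt  = arc-tgt
    ; arc-edge = λ xy → complete (arc-src xy) (arc-tgt xy) (arc-≢ xy)
    ; edge-arc = edge-arc
    ; antisym  = antisym
    }

  side : Fin n → Bool
  side x = does (x ≟ b)

  side-b : side b ≡ true
  side-b = dec-true (b ≟ b) refl

  side-≢b : x ≢ b → side x ≡ false
  side-≢b {x} x≢b = dec-false (x ≟ b) x≢b

  side-≢ : x ≢ b → side x ≢ side b
  side-≢ x≢b e with trans (sym (side-≢b x≢b)) (trans e side-b)
  ... | ()

  bothSides : BothSides S side
  bothSides true  = b , b∈S , side-b
  bothSides false = a , a∈S , side-≢b (≢-sym b≢a)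

  isGood : IsGood R S Arc side
  isGood = isOrientation , same-side
    where
    same-side : ∀ x y → x ∈ S → y ∈ S → side x ≡ side y → Dist≤2 Arc x y
    same-side x y x∈S y∈S sx≡sy with cover x∈S | cover y∈S
    ... | inj₁ refl        | inj₁ refl        = inj₁ (inj₁ refl)
    ... | inj₂ (inj₁ refl) | inj₂ (inj₁ refl) = inj₁ (inj₁ refl)
    ... | inj₂ (inj₂ refl) | inj₂ (inj₂ refl) = inj₁ (inj₁ refl)
    ... | inj₁ refl        | inj₂ (inj₂ refl) = inj₂ (b , a→b refl refl , b→c refl refl)
    ... | inj₂ (inj₂ refl) | inj₁ refl        = inj₁ (inj₂ (c→a refl refl))
    ... | inj₁ refl        | inj₂ (inj₁ refl) = ⊥-elim (side-≢ (≢-sym b≢a) sx≡sy)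
    ... | inj₂ (inj₂ refl) | inj₂ (inj₁ refl) = ⊥-elim (side-≢ c≢b sx≡sy)
    ... | inj₂ (inj₁ refl) | inj₁ refl        = ⊥-elim (side-≢ (≢-sym b≢a) (sym sx≡sy))
    ... | inj₂ (inj₁ refl) | inj₂ (inj₂ refl) = ⊥-elim (side-≢ c≢b (sym sx≡sy))

∣S∣≡3⇒twoSidedGood : (R : SimpleGraph n) (S : Subset n) → ∣ S ∣ ≡ 3 →
  (∀ {x y} → x ∈ S → y ∈ S → x ≢ y → Adj R x y) → HasTwoSidedGoodOrientation R S
∣S∣≡3⇒twoSidedGood R S ∣S∣≡3 complete with ∣p∣≡3⇒triple S ∣S∣≡3
... | a , b , c , a∈S , b∈S , c∈S , b≢a , c≢b , c≢a , cover =
  Arc , side , isGood , bothSides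
  where open CyclicTriangle R S a∈S b∈S c∈S b≢a c≢b c≢a cover complete

module Join {n} (R : SimpleGraph n) (W : Subset n)
  (cross-¬CoAdj : ∀ x z → x ∈ W → z ∉ W → ¬ CoAdj R x z)
  {OW : Fin n → Fin n → Set} {sW : Fin n → Bool} (ntW : IsNonTrivialGood R W OW sW)
  {OZ : Fin n → Fin n → Set} {sZ : Fin n → Bool} (goodZ : IsGood R (∁ W) OZ sZ)
  (bothZ : BothSides (∁ W) sZ) (W-nonempty : ∃[ w ] w ∈ W)
  where

  private
    isOW : IsOrientation R W OW
    isOW = proj₁ (proj₁ ntW)

    module OW = IsOrientation isOW
    module OZ = IsOrientation (proj₁ goodZ)

  data Arc (x y : Fin n) : Set where
    inW : x ∈ W → y ∈ W → OW x y → Arc x y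
    inZ : x ∉ W → y ∉ W → OZ x y → Arc x y
    W→Z : x ∈ W → y ∉ W → sW x ≡ sZ y → Arc x y
    Z→W : x ∉ W → y ∈ W → sZ x ≢ sW y → Arc x y

  private
    cross-adj : ∀ {x y} → x ∈ W → y ∉ W → Adj R x y
    cross-adj x∈W y∉W =
      ¬CoAdj⇒Adj R (λ { refl → y∉W x∈W }) (cross-¬CoAdj _ _ x∈W y∉W)

    arc-edge : ∀ {x y} → Arc x y → Adj R x y
    arc-edge (inW _ _ xy)       = OW.arc-edge xy
    arc-edge (inZ _ _ xy)       = OZ.arc-edge xy
    arc-edge (W→Z x∈W y∉W _)    = cross-adj x∈W y∉W
    arc-edge (Z→W x∉W y∈W _)    = Adj-sym R (cross-adj y∈W x∉W)

    edge-arc : ∀ {x y} → x ∈ ⊤ → y ∈ ⊤ → Adj R x y → Arc x y ⊎ Arc y x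
    edge-arc {x} {y} _ _ xy with x ∈? W | y ∈? W
    ... | yes x∈W | yes y∈W with OW.edge-arc x∈W y∈W xy
    ...   | inj₁ xy′ = inj₁ (inW x∈W y∈W xy′)
    ...   | inj₂ yx′ = inj₂ (inW y∈W x∈W yx′)
    edge-arc _ _ xy | no x∉W | no y∉W with OZ.edge-arc (x∉p⇒x∈∁p x∉W) (x∉p⇒x∈∁p y∉W) xy
    ...   | inj₁ xy′ = inj₁ (inZ x∉W y∉W xy′)
    ...   | inj₂ yx′ = inj₂ (inZ y∉W x∉W yx′)
    edge-arc {x} {y} _ _ _ | yes x∈W | no y∉W with sW x ≟ᵇ sZ y
    ...   | yes sx≡sy = inj₁ (W→Z x∈W y∉W sx≡sy)
    ...   | no sx≢sy  = inj₂ (Z→W y∉W x∈W (sx≢sy ∘ sym))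
    edge-arc {x} {y} _ _ _ | no x∉W | yes y∈W with sW y ≟ᵇ sZ x
    ...   | yes sy≡sx = inj₂ (W→Z y∈W x∉W sy≡sx)
    ...   | no sy≢sx  = inj₁ (Z→W x∉W y∈W (sy≢sx ∘ sym))

    antisym : ∀ {x y} → Arc x y → ¬ Arc y x
    antisym (inW _ _ xy)       (inW _ _ yx)       = OW.antisym xy yx
    antisym (inZ _ _ xy)       (inZ _ _ yx)       = OZ.antisym xy yx
    antisym (W→Z _ _ sx≡sy)    (Z→W _ _ sy≢sx)    = sy≢sx (sym sx≡sy)
    antisym (Z→W _ _ sx≢sy)    (W→Z _ _ sy≡sx)    = sx≢sy (sym sy≡sx)
    antisym (inW x∈W _ _)      (inZ _ x∉W _)      = x∉W x∈W
    antisym (inW x∈W _ _)      (W→Z _ x∉W _)      = x∉W x∈W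
    antisym (inW _ y∈W _)      (Z→W y∉W _ _)      = y∉W y∈W
    antisym (inZ x∉W _ _)      (inW _ x∈W _)      = x∉W x∈W
    antisym (inZ _ y∉W _)      (W→Z y∈W _ _)      = y∉W y∈W
    antisym (inZ x∉W _ _)      (Z→W _ x∈W _)      = x∉W x∈W
    antisym (W→Z _ y∉W _)      (inW y∈W _ _)      = y∉W y∈W
    antisym (W→Z x∈W _ _)      (inZ _ x∉W _)      = x∉W x∈W
    antisym (W→Z _ y∉W _)      (W→Z y∈W _ _)      = y∉W y∈W
    antisym (Z→W x∉W _ _)      (inW _ x∈W _)      = x∉W x∈W
    antisym (Z→W _ y∈W _)      (inZ y∉W _ _)      = y∉W y∈W
    antisym (Z→W _ y∈W _)      (Z→W y∉W _ _)      = y∉W y∈W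

  isOrientation : IsOrientation R ⊤ Arc
  isOrientation = record
    { arc-src  = λ _ → ∈⊤
    ; arc-tgt  = λ _ → ∈⊤
    ; arc-edge = arc-edge
    ; edge-arc = edge-arc
    ; antisym  = antisym
    }

  private
    liftW : ∀ {x y} → OW x y → Arc x y
    liftW xy = inW (OW.arc-src xy) (OW.arc-tgt xy) xy

    liftZ : ∀ {x y} → OZ x y → Arc x y
    liftZ xy = inZ (x∈∁p⇒x∉p (OZ.arc-src xy)) (x∈∁p⇒x∉p (OZ.arc-tgt xy)) xy

    same-sideW : ∀ x y → x ∈ W → y ∈ W → sW x ≡ sW y → Dist≤2 OW x y
    same-sideW = proj₂ (proj₁ ntW)

    in-neighbourW : ∀ x → x ∈ W → ∃[ y ] (y ∈ W × sW y ≢ sW x × OW y x)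
    in-neighbourW = proj₁ (proj₂ ntW)

    out-neighbourW : ∀ x → x ∈ W → ∃[ y ] (y ∈ W × sW y ≢ sW x × OW x y)
    out-neighbourW = proj₂ (proj₂ ntW)

    bothW : BothSides W sW
    bothW = nonTrivialGood⇒bothSides W-nonempty ntW

    dist-WW : ∀ {x y} → x ∈ W → y ∈ W → Dist≤2 Arc x y
    dist-WW {x} {y} x∈W y∈W with sW x ≟ᵇ sW y
    ... | yes sx≡sy = Dist≤2-map liftW (same-sideW x y x∈W y∈W sx≡sy)
    ... | no sx≢sy with bothZ (sW x)
    ...   | z , z∈Z , sz≡sx =
      inj₂ (z , W→Z x∈W (x∈∁p⇒x∉p z∈Z) (sym sz≡sx)
              , Z→W (x∈∁p⇒x∉p z∈Z) y∈W (sx≢sy ∘ trans (sym sz≡sx)))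

    dist-WZ : ∀ {x y} → x ∈ W → y ∉ W → Dist≤2 Arc x y
    dist-WZ {x} {y} x∈W y∉W with sW x ≟ᵇ sZ y
    ... | yes sx≡sy = inj₁ (inj₂ (W→Z x∈W y∉W sx≡sy))
    ... | no sx≢sy with out-neighbourW x x∈W
    ...   | w , w∈W , sw≢sx , xw =
      inj₂ (w , liftW xw , W→Z w∈W y∉W (both≢⇒≡ sw≢sx (sx≢sy ∘ sym)))

    dist-ZW : ∀ {x y} → x ∉ W → y ∈ W → Dist≤2 Arc x y
    dist-ZW {x} {y} x∉W y∈W with sZ x ≟ᵇ sW y
    ... | no sx≢sy = inj₁ (inj₂ (Z→W x∉W y∈W sx≢sy))
    ... | yes sx≡sy with in-neighbourW y y∈W
    ...   | w , w∈W , sw≢sy , wy =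
      inj₂ (w , Z→W x∉W w∈W (λ sx≡sw → sw≢sy (trans (sym sx≡sw) sx≡sy)) , liftW wy)

    dist-ZZ : ∀ {x y} → x ∉ W → y ∉ W → Dist≤2 Arc x y
    dist-ZZ {x} {y} x∉W y∉W with sZ x ≟ᵇ sZ y
    ... | yes sx≡sy = Dist≤2-map liftZ (proj₂ goodZ x y (x∉p⇒x∈∁p x∉W) (x∉p⇒x∈∁p y∉W) sx≡sy)
    ... | no sx≢sy with bothW (sZ y)
    ...   | w , w∈W , sw≡sy =
      inj₂ (w , Z→W x∉W w∈W (λ sx≡sw → sx≢sy (trans sx≡sw sw≡sy)) , W→Z w∈W y∉W sw≡sy)

  dist≤2 : ∀ x y → Dist≤2 Arc x y
  dist≤2 x y with x ∈? W | y ∈? W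
  ... | yes x∈W | yes y∈W = dist-WW x∈W y∈W
  ... | yes x∈W | no y∉W  = dist-WZ x∈W y∉W
  ... | no x∉W  | yes y∈W = dist-ZW x∉W y∈W
  ... | no x∉W  | no y∉W  = dist-ZZ x∉W y∉W

  not-complete : ∃[ x ] ∃[ y ] ¬ Dist≤1 Arc x y
  not-complete =
    let (w , w∈W) = W-nonempty
        (y , _ , sy≢sw , yw) = in-neighbourW w w∈W
    in w , y , λ { (inj₁ w≡y) → sy≢sw (cong sW (sym w≡y)) ; (inj₂ wy) → antisym (liftW yw) wy }

  hasOrientationOfDiameter2 : HasOrientationOfDiameter2 R
  hasOrientationOfDiameter2 = Arc , isOrientation , dist≤2 , not-complete

twoSidedGood⇒diameter2 : (R : SimpleGraph n) (W : Subset n) → ∃[ w ] w ∈ W →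
  (∀ x z → x ∈ W → z ∉ W → ¬ CoAdj R x z) →
  HasNonTrivialGoodOrientation R W → HasTwoSidedGoodOrientation R (∁ W) →
  HasOrientationOfDiameter2 R
twoSidedGood⇒diameter2 R W W-nonempty cross-¬CoAdj (_ , _ , ntW) (_ , _ , goodZ , bothZ) =
  Join.hasOrientationOfDiameter2 R W cross-¬CoAdj ntW goodZ bothZ W-nonempty

lemma3 : ∀ {n} (R : SimpleGraph n) (W : Subset n) →
    (∃[ w ] w ∈ W) → (∃[ z ] z ∉ W) →
    (∀ x z → x ∈ W → z ∉ W → ¬ CoAdj R x z) →
    HasNonTrivialGoodOrientation R W →
    (HasNonTrivialGoodOrientation R (∁ W)
      ⊎ (∣ ∁ W ∣ ≡ 3 × (∀ z y → z ∉ W → ¬ CoAdj R z y))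
      ⊎ ∣ ∁ W ∣ ≡ 2) →
    HasOrientationOfDiameter2 R
lemma3 R W W-nonempty (z , z∉W) cross hW (inj₁ hZ) =
  twoSidedGood⇒diameter2 R W W-nonempty cross hW
    (nonTrivialGood⇒twoSidedGood (z , x∉p⇒x∈∁p z∉W) hZ)
lemma3 R W W-nonempty _ cross hW (inj₂ (inj₁ (∣Z∣≡3 , Z-isolated))) =
  twoSidedGood⇒diameter2 R W W-nonempty cross hW
    (∣S∣≡3⇒twoSidedGood R (∁ W) ∣Z∣≡3 λ x∈Z _ x≢y →
      ¬CoAdj⇒Adj R x≢y (Z-isolated _ _ (x∈∁p⇒x∉p x∈Z)))
lemma3 R W W-nonempty _ cross hW (inj₂ (inj₂ ∣Z∣≡2)) =
  twoSidedGood⇒diameter2 R W W-nonempty cross hW (∣S∣≡2⇒twoSidedGood R (∁ W) ∣Z∣≡2)
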